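{- Let $G$ be a semicomplete digraph and $d\ge0$, $l>0$, $w>0$ integers. Suppose $G$ has a $(d,3l,w)$-matching tangle $(T_1,T_2)$. Then $G$ has either a tame $(d,l,w)$-matching tangle or a $(d,l,w)$-spider.
   Context: Digraphs are simple; $G$ is semicomplete if between every two distinct vertices there is at least one edge. $N^\pm(v)$ are out-/in-neighborhoods, $d^+(v)=|N^+(v)|$; $V^+_{\le d}(G)$, $V^+_{\ge d}(G)$ are the sets of vertices with $d^+\le d$, resp. $d^+\ge d$. ${\rm wld}(v)=|V^+_{\le d^+(v)}(G)\setminus N^+(v)|$. ${\rm pw}(G)$ is the pathwidth, where a path-decomposition is a sequence of bags $(X_1,\dots,X_m)$ covering $V(G)$, with each vertex's bags forming an interval of indices, and for each edge $(u,v)$ some $i\ge j$ with $u\in X_i$, $v\in X_j$; width $\max|X_i|-1$. A $(d,l,w)$-matching tangle is a pair $(T_1,T_2)$ with $|T_1|=|T_2|=l$, $T_1\subseteq V^+_{\le d}(G)$, $T_2\subseteq V^+_{\ge d+w+1}(G)$, and a bijection $\phi:T_1\to T_2$ with $(v,\phi(v))\in E(G)$ for all $v\in T_1$. It is tame if ${\rm wld}(v)\le 3l+d+w-d^+(v)+2{\rm pw}(G)$ for each $v\in T_1$ and ${\rm wld}(v)\le 3l+d^+(v)-d+2{\rm pw}(G)$ for each $v\in T_2$. A $(d,l,w)$-spider is a triple $(T,L,R)$ with $|T|\ge l$, $L=\{L_v\}_{v\in T}$, $R=\{R_v\}_{v\in T}$ such that for each $v\in T$: $L_v\subseteq N^-(v)$,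 $|L_v|\ge3l$, $d^+(u)\le d$ for all $u\in L_v$, $R_v\subseteq N^+(v)$, $|R_v|\ge3l$, and $d^+(u)\ge d+w$ for all $u\in R_v$. -}

module Defs where

open import Data.Bool using (Bool; true; false; if_then_else_)
open import Data.Nat using (ℕ; suc; _+_; _*_; _∸_; _≤_; _≤ᵇ_)
open import Data.Fin using (Fin)
open import Data.Fin.Subset using (Subset; _∈_; _⊆_; _─_; ∣_∣; inside; outside)
open import Data.Vec using (tabulate)
open import Data.Product using (Σ; ∃; _×_)
open import Relation.Binary.PropositionalEquality using (_≡_; _≢_)
open import Data.Sum using (_⊎_)

record Digraph (n : ℕ) : Set where
  field
    edge     : Fin n → Fin n → Bool
    loopless : ∀ v → edge v v ≡ false
open Digraph public

Semicomplete : ∀ {n} → Digraph n → Set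
Semicomplete G = ∀ u v → u ≢ v → edge G u v ≡ true ⊎ edge G v u ≡ true

toSub : Bool → Bool
toSub b = if b then inside else outside

N⁺ : ∀ {n} → Digraph n → Fin n → Subset n
N⁺ G v = tabulate (λ u → toSub (edge G v u))

N⁻ : ∀ {n} → Digraph n → Fin n → Subset n
N⁻ G v = tabulate (λ u → toSub (edge G u v))

d⁺ : ∀ {n} → Digraph n → Fin n → ℕ
d⁺ G v = ∣ N⁺ G v ∣

V⁺≤ : ∀ {n} → Digraph n → ℕ → Subset n
V⁺≤ G d = tabulate (λ u → toSub (d⁺ G u ≤ᵇ d))

V⁺≥ : ∀ {n} → Digraph n → ℕ → Subset n
V⁺≥ G d = tabulate (λ u → toSub (d ≤ᵇ d⁺ G u))

wld : ∀ {n} → Digraph n → Fin n → ℕ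
wld G v = ∣ V⁺≤ G (d⁺ G v) ─ N⁺ G v ∣

record PathDecomposition {n} (G : Digraph n) : Set where
  field
    m      : ℕ
    bag    : Fin m → Subset n
    cover  : ∀ v → ∃ λ i → v ∈ bag i
    interval : ∀ v (i j k : Fin m) → i Data.Fin.≤ j → j Data.Fin.≤ k →
               v ∈ bag i → v ∈ bag k → v ∈ bag j
    edges  : ∀ u v → edge G u v ≡ true →
             Σ (Fin m) λ i → Σ (Fin m) λ j → j Data.Fin.≤ i × u ∈ bag i × v ∈ bag j
open PathDecomposition public

-- width ≤ k  iff  every bag has at most k+1 vertices (width = max |X_i| - 1)
WidthAtMost : ∀ {n} {G : Digraph n} → PathDecomposition G → ℕ → Set
WidthAtMost D k = ∀ i → ∣ bag D i ∣ ≤ suc k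

IsPathwidth : ∀ {n} → Digraph n → ℕ → Set
IsPathwidth G p =
  (Σ (PathDecomposition G) λ D → WidthAtMost D p) ×
  (∀ (D : PathDecomposition G) k → WidthAtMost D k → p ≤ k)

record MatchingTangle {n} (G : Digraph n) (d l w : ℕ) : Set where
  field
    T₁ T₂  : Subset n
    size₁  : ∣ T₁ ∣ ≡ l
    size₂  : ∣ T₂ ∣ ≡ l
    T₁-low : T₁ ⊆ V⁺≤ G d
    T₂-high : T₂ ⊆ V⁺≥ G (d + w + 1)
    φ      : Fin n → Fin n
    φ-into : ∀ {v} → v ∈ T₁ → φ v ∈ T₂
    φ-inj  : ∀ {u v} → u ∈ T₁ → v ∈ T₁ → φ u ≡ φ v → u ≡ v
    φ-onto : ∀ {x} → x ∈ T₂ → ∃ λ v → v ∈ T₁ × φ v ≡ x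
    φ-edge : ∀ {v} → v ∈ T₁ → edge G v (φ v) ≡ true
open MatchingTangle public

-- tameness, relative to pw = pw(G)
Tame : ∀ {n} {G : Digraph n} {d l w : ℕ} → ℕ → MatchingTangle G d l w → Set
Tame {G = G} {d} {l} {w} pw M =
  (∀ {v} → v ∈ T₁ M → wld G v ≤ 3 * l + (d + w ∸ d⁺ G v) + 2 * pw) ×
  (∀ {v} → v ∈ T₂ M → wld G v ≤ 3 * l + (d⁺ G v ∸ d) + 2 * pw)

record Spider {n} (G : Digraph n) (d l w : ℕ) : Set where
  field
    T     : Subset n
    sizeT : l ≤ ∣ T ∣
    L R   : Fin n → Subset n
    L-in  : ∀ {v} → v ∈ T → L v ⊆ N⁻ G v
    L-size : ∀ {v} → v ∈ T → 3 * l ≤ ∣ L v ∣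
    L-low : ∀ {v u} → v ∈ T → u ∈ L v → d⁺ G u ≤ d
    R-in  : ∀ {v} → v ∈ T → R v ⊆ N⁺ G v
    R-size : ∀ {v} → v ∈ T → 3 * l ≤ ∣ R v ∣
    R-high : ∀ {v u} → v ∈ T → u ∈ R v → d + w ≤ d⁺ G u

module Submission where

-- Call a vertex of T₁ ∪ T₂ wild when it violates its tameness bound.  Pathwidth p
-- controls the low-degree part of a semicomplete digraph from both sides:
-- |V⁺≤ t| ≤ t + p + 1, since the vertex of V⁺≤ t entering the decomposition last
-- dominates every vertex of V⁺≤ t outside its first bag; and t < |V⁺≤ t| + p when
-- some out-degree exceeds t, since the vertex of V⁺≥ (t + 1) leaving the
-- decomposition first has its out-neighbours in V⁺≥ (t + 1) inside its last bag.
-- These two bounds turn a large wld(v) into 3l in-neighbours of out-degree ≤ d and 3l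
-- out-neighbours of out-degree ≥ d + w, so l wild vertices form a spider.  With
-- fewer than l wild vertices, at most 2(l − 1) of the 3l matching edges meet one,
-- and l of the others form a tame tangle.

open import Defs
open import Data.Bool using (Bool; true; false)
open import Data.Bool.Properties using (T-≡) renaming (_≟_ to _≟ᵇ_)
open import Data.Empty using (⊥-elim)
open import Data.Fin as Fin using (Fin; zero; suc)
open import Data.Fin.Properties as Fin using (any?)
open import Data.Fin.Subset
  using (Subset; _∈_; _∉_; _⊆_; _─_; _-_; _∪_; _∩_; ∣_∣; inside; outside; ⁅_⁆; ⊥; Empty)
open import Data.Fin.Subset.Properties
open import Data.Nat using (ℕ; zero; suc; _+_; _*_; _∸_; _≤_; _<_; _≤?_; z≤n; s≤s)
open import Data.Nat.Properties
open import Algebra.Properties.CommutativeSemigroup +-commutativeSemigroup using (x∙yz≈y∙xz)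
open import Data.Product using (Σ; ∃; _×_; _,_; proj₁; proj₂)
open import Data.Sum using (_⊎_; inj₁; inj₂; [_,_]′)
open import Data.Vec using ([]; _∷_; tabulate; here; there)
open import Data.Vec.Properties using (lookup∘tabulate; []=⇒lookup; lookup⇒[]=)
open import Function using (_∘_; id; flip; Equivalence)
open import Relation.Binary.Core using (Rel)
open import Relation.Binary.Definitions using (Total; Transitive)
open import Relation.Binary.PropositionalEquality
  using (_≡_; _≢_; refl; sym; trans; cong; subst; ≢-sym)
open import Relation.Nullary using (Dec; yes; no; ¬_; contradiction)
open import Relation.Nullary.Decidable using (⌊_⌋; fromWitness; toWitness; _×-dec_; _⊎-dec_; ¬?)
open import Relation.Unary using (Pred; Decidable)

∈-tabulate⁺ : ∀ {n} (f : Fin n → Bool) {x} → f x ≡ true → x ∈ tabulate f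
∈-tabulate⁺ f {x} fx≡true = lookup⇒[]= x _ (trans (lookup∘tabulate f x) fx≡true)

∈-tabulate⁻ : ∀ {n} (f : Fin n → Bool) {x} → x ∈ tabulate f → f x ≡ true
∈-tabulate⁻ f {x} x∈ = trans (sym (lookup∘tabulate f x)) ([]=⇒lookup x∈)

toSubset : ∀ {n p} {P : Pred (Fin n) p} → Decidable P → Subset n
toSubset P? = tabulate (λ x → ⌊ P? x ⌋)

module _ {n p} {P : Pred (Fin n) p} (P? : Decidable P) where

  ∈toSubset⁺ : ∀ {x} → P x → x ∈ toSubset P?
  ∈toSubset⁺ Px = ∈-tabulate⁺ _ (Equivalence.to T-≡ (fromWitness Px))

  ∈toSubset⁻ : ∀ {x} → x ∈ toSubset P? → P x
  ∈toSubset⁻ x∈ = toWitness (Equivalence.from T-≡ (∈-tabulate⁻ _ x∈))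

image : ∀ {m n} → (Fin m → Fin n) → Subset m → Subset n
image f q = toSubset (λ y → any? (λ x → x ∈? q ×-dec f x Fin.≟ y))

module _ {m n} (f : Fin m → Fin n) (q : Subset m) where

  ∈image⁺ : ∀ {x} → x ∈ q → f x ∈ image f q
  ∈image⁺ {x} x∈q = ∈toSubset⁺ _ (x , x∈q , refl)

  ∈image⁻ : ∀ {y} → y ∈ image f q → ∃ λ x → x ∈ q × f x ≡ y
  ∈image⁻ = ∈toSubset⁻ _

x∈p─q⇒x∉q : ∀ {n} {p q : Subset n} {x} → x ∈ p ─ q → x ∉ q
x∈p─q⇒x∉q {p = _ ∷ _} {inside ∷ _} {zero} ()
x∈p─q⇒x∉q {p = _ ∷ _} {_ ∷ _} {suc x} (there x∈) (there x∈q) = x∈p─q⇒x∉q x∈ x∈q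

∣p∪q∣+∣p∩q∣≡∣p∣+∣q∣ : ∀ {n} (p q : Subset n) → ∣ p ∪ q ∣ + ∣ p ∩ q ∣ ≡ ∣ p ∣ + ∣ q ∣
∣p∪q∣+∣p∩q∣≡∣p∣+∣q∣ []            []            = refl
∣p∪q∣+∣p∩q∣≡∣p∣+∣q∣ (inside  ∷ p) (inside  ∷ q) =
  cong suc (trans (+-suc _ _) (trans (cong suc (∣p∪q∣+∣p∩q∣≡∣p∣+∣q∣ p q)) (sym (+-suc _ _))))
∣p∪q∣+∣p∩q∣≡∣p∣+∣q∣ (inside  ∷ p) (outside ∷ q) = cong suc (∣p∪q∣+∣p∩q∣≡∣p∣+∣q∣ p q)
∣p∪q∣+∣p∩q∣≡∣p∣+∣q∣ (outside ∷ p) (inside  ∷ q) =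
  trans (cong suc (∣p∪q∣+∣p∩q∣≡∣p∣+∣q∣ p q)) (sym (+-suc _ _))
∣p∪q∣+∣p∩q∣≡∣p∣+∣q∣ (outside ∷ p) (outside ∷ q) = ∣p∪q∣+∣p∩q∣≡∣p∣+∣q∣ p q

Empty⇒∣p∣≡0 : ∀ {n} {p : Subset n} → Empty p → ∣ p ∣ ≡ 0
Empty⇒∣p∣≡0 {n} p-empty = trans (cong ∣_∣ (Empty-unique p-empty)) (∣⊥∣≡0 n)

p⊆q∪r⇒∣p∣≤∣q∣+∣r∣ : ∀ {n} {p : Subset n} (q r : Subset n) → p ⊆ q ∪ r → ∣ p ∣ ≤ ∣ q ∣ + ∣ r ∣
p⊆q∪r⇒∣p∣≤∣q∣+∣r∣ {p = p} q r p⊆q∪r = begin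
  ∣ p ∣                    ≤⟨ p⊆q⇒∣p∣≤∣q∣ p⊆q∪r ⟩
  ∣ q ∪ r ∣                ≤⟨ m≤m+n _ _ ⟩
  ∣ q ∪ r ∣ + ∣ q ∩ r ∣    ≡⟨ ∣p∪q∣+∣p∩q∣≡∣p∣+∣q∣ q r ⟩
  ∣ q ∣ + ∣ r ∣            ∎
  where open ≤-Reasoning

disjoint⇒∣p∣+∣q∣≤∣r∣ : ∀ {n} (p q r : Subset n) →
                       (∀ {x} → x ∈ p → x ∉ q) → p ⊆ r → q ⊆ r → ∣ p ∣ + ∣ q ∣ ≤ ∣ r ∣
disjoint⇒∣p∣+∣q∣≤∣r∣ p q r disjoint p⊆r q⊆r = begin
  ∣ p ∣ + ∣ q ∣              ≡⟨ ∣p∪q∣+∣p∩q∣≡∣p∣+∣q∣ p q ⟨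
  ∣ p ∪ q ∣ + ∣ p ∩ q ∣      ≡⟨ cong (∣ p ∪ q ∣ +_) (Empty⇒∣p∣≡0 p∩q-empty) ⟩
  ∣ p ∪ q ∣ + 0              ≡⟨ +-identityʳ _ ⟩
  ∣ p ∪ q ∣                  ≤⟨ p⊆q⇒∣p∣≤∣q∣ p∪q⊆r ⟩
  ∣ r ∣                      ∎
  where
  open ≤-Reasoning
  p∩q-empty : Empty (p ∩ q)
  p∩q-empty (x , x∈p∩q) = let (x∈p , x∈q) = x∈p∩q⁻ p q x∈p∩q in disjoint x∈p x∈q
  p∪q⊆r : p ∪ q ⊆ r
  p∪q⊆r x∈ with x∈p∪q⁻ p q x∈
  ... | inj₁ x∈p = p⊆r x∈p
  ... | inj₂ x∈q = q⊆r x∈q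

∣p∣≤1+∣p-x∣ : ∀ {n} (p : Subset n) x → ∣ p ∣ ≤ suc ∣ p - x ∣
∣p∣≤1+∣p-x∣ p x = begin
  ∣ p ∣                      ≤⟨ p⊆q∪r⇒∣p∣≤∣q∣+∣r∣ (p - x) ⁅ x ⁆ p⊆p-x∪⁅x⁆ ⟩
  ∣ p - x ∣ + ∣ ⁅ x ⁆ ∣      ≡⟨ cong (∣ p - x ∣ +_) (∣⁅x⁆∣≡1 x) ⟩
  ∣ p - x ∣ + 1              ≡⟨ +-comm _ 1 ⟩
  suc ∣ p - x ∣              ∎
  where
  open ≤-Reasoning
  p⊆p-x∪⁅x⁆ : p ⊆ (p - x) ∪ ⁅ x ⁆
  p⊆p-x∪⁅x⁆ {y} y∈p with y Fin.≟ x
  ... | yes refl = x∈p∪q⁺ (inj₂ (x∈⁅x⁆ x))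
  ... | no  y≢x  = x∈p∪q⁺ (inj₁ (x∈p∧x≢y⇒x∈p-y y∈p y≢x))

module _ {m n} (f : Fin m → Fin n) where

  injective⇒∣p∣≤∣q∣ : ∀ {p : Subset m} {q : Subset n} → (∀ {x} → x ∈ p → f x ∈ q) →
                      (∀ {x y} → x ∈ p → y ∈ p → f x ≡ f y → x ≡ y) → ∣ p ∣ ≤ ∣ q ∣
  injective⇒∣p∣≤∣q∣ {p} = bounded ∣ p ∣ ≤-refl
    where
    bounded : ∀ k {p : Subset m} {q : Subset n} → ∣ p ∣ ≤ k → (∀ {x} → x ∈ p → f x ∈ q) →
              (∀ {x y} → x ∈ p → y ∈ p → f x ≡ f y → x ≡ y) → ∣ p ∣ ≤ ∣ q ∣
    bounded zero    ∣p∣≤0   _    _   = ≤-trans ∣p∣≤0 z≤n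
    bounded (suc k) {p} {q} ∣p∣≤1+k into inj with nonempty? p
    ... | no  p-empty = subst (_≤ ∣ q ∣) (sym (Empty⇒∣p∣≡0 p-empty)) z≤n
    ... | yes (x , x∈p) = begin
      ∣ p ∣             ≤⟨ ∣p∣≤1+∣p-x∣ p x ⟩
      suc ∣ p - x ∣     ≤⟨ s≤s (bounded k ∣p-x∣≤k into-q-fx (λ y∈ z∈ → inj (p─q⊆p p _ y∈) (p─q⊆p p _ z∈))) ⟩
      suc ∣ q - f x ∣   ≤⟨ x∈p⇒∣p-x∣<∣p∣ (into x∈p) ⟩
      ∣ q ∣             ∎
      where
      open ≤-Reasoning
      ∣p-x∣≤k : ∣ p - x ∣ ≤ k
      ∣p-x∣≤k = ≤-pred (≤-trans (x∈p⇒∣p-x∣<∣p∣ x∈p) ∣p∣≤1+k)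
      into-q-fx : ∀ {y} → y ∈ p - x → f y ∈ q - f x
      into-q-fx {y} y∈p-x = x∈p∧x≢y⇒x∈p-y (into y∈p) fy≢fx
        where
        y∈p = p─q⊆p p _ y∈p-x
        fy≢fx : f y ≢ f x
        fy≢fx fy≡fx = x∈p─q⇒x∉q y∈p-x (subst (_∈ ⁅ x ⁆) (sym (inj y∈p x∈p fy≡fx)) (x∈⁅x⁆ x))

-- The section used below needs a default value in the domain, hence a common index n.
module _ {n} (f : Fin n → Fin n) where

  surjective⇒∣q∣≤∣p∣ : ∀ {p q : Subset n} → (∀ {y} → y ∈ q → ∃ λ x → x ∈ p × f x ≡ y) → ∣ q ∣ ≤ ∣ p ∣
  surjective⇒∣q∣≤∣p∣ {p} {q} onto =
    injective⇒∣p∣≤∣q∣ section (proj₁ ∘ section-spec)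
      (λ y∈q z∈q eq → trans (sym (proj₂ (section-spec y∈q))) (trans (cong f eq) (proj₂ (section-spec z∈q))))
    where
    preimage? : ∀ y → Dec (∃ λ x → x ∈ p × f x ≡ y)
    preimage? y = any? (λ x → x ∈? p ×-dec f x Fin.≟ y)
    section : Fin n → Fin n
    section y with preimage? y
    ... | yes (x , _) = x
    ... | no  _       = y
    section-spec : ∀ {y} → y ∈ q → section y ∈ p × f (section y) ≡ y
    section-spec {y} y∈q with preimage? y
    ... | yes (_ , x∈p , fx≡y) = x∈p , fx≡y
    ... | no  ∄preimage        = ⊥-elim (∄preimage (onto y∈q))

  ∣image∣≡∣p∣ : ∀ {p : Subset n} → (∀ {x y} → x ∈ p → y ∈ p → f x ≡ f y → x ≡ y) → ∣ image f p ∣ ≡ ∣ p ∣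
  ∣image∣≡∣p∣ {p} inj = ≤-antisym (surjective⇒∣q∣≤∣p∣ (∈image⁻ f p)) (injective⇒∣p∣≤∣q∣ f (∈image⁺ f p) inj)

subsetOfSize : ∀ {n} k (p : Subset n) → k ≤ ∣ p ∣ → ∃ λ q → q ⊆ p × ∣ q ∣ ≡ k
subsetOfSize {n} zero    p             _           = ⊥ , ⊥⊆ , ∣⊥∣≡0 n
subsetOfSize     (suc k) (inside  ∷ p) (s≤s k≤∣p∣) =
  let (q , q⊆p , ∣q∣≡k) = subsetOfSize k p k≤∣p∣ in inside ∷ q , in⊆in q⊆p , cong suc ∣q∣≡k
subsetOfSize     (suc k) (outside ∷ p) k<∣p∣       =
  let (q , q⊆p , ∣q∣≡k) = subsetOfSize (suc k) p k<∣p∣ in outside ∷ q , s⊆s q⊆p , ∣q∣≡k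

module _ {a r} {A : Set a} {_≼_ : Rel A r} (total : Total _≼_) (≼-trans : Transitive _≼_) where

  private
    ≼-refl : ∀ b → b ≼ b
    ≼-refl b = [ id , id ]′ (total b b)

  argmax : ∀ {n p} {P : Pred (Fin n) p} → Decidable P → (f : Fin n → A) → ∃ P →
           ∃ λ z → P z × ∀ {x} → P x → f x ≼ f z
  argmax {suc n} {P = P} P? f ∃P with any? (P? ∘ suc)
  ... | no ∄Psuc = zero , P-zero ∃P , below
    where
    P-zero : ∃ P → P zero
    P-zero (zero  , P0) = P0
    P-zero (suc y , Py) = ⊥-elim (∄Psuc (y , Py))
    below : ∀ {x} → P x → f x ≼ f zero
    below {zero}  _  = ≼-refl (f zero)
    below {suc y} Py = ⊥-elim (∄Psuc (y , Py))
  ... | yes ∃Psuc with argmax (P? ∘ suc) (f ∘ suc) ∃Psuc | P? zero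
  ...   | z , Psz , below-z | no ¬P0 = suc z , Psz , below
    where
    below : ∀ {x} → P x → f x ≼ f (suc z)
    below {zero}  P0 = ⊥-elim (¬P0 P0)
    below {suc y} Py = below-z Py
  ...   | z , Psz , below-z | yes P0 with total (f zero) (f (suc z))
  ...     | inj₁ f0≼fz = suc z , Psz , below
    where
    below : ∀ {x} → P x → f x ≼ f (suc z)
    below {zero}  _  = f0≼fz
    below {suc y} Py = below-z Py
  ...     | inj₂ fz≼f0 = zero , P0 , below
    where
    below : ∀ {x} → P x → f x ≼ f zero
    below {zero}  _  = ≼-refl (f zero)
    below {suc y} Py = ≼-trans (below-z Py) fz≼f0

argmin : ∀ {a r} {A : Set a} {_≼_ : Rel A r} → Total _≼_ → Transitive _≼_ →
         ∀ {n p} {P : Pred (Fin n) p} → Decidable P → (f : Fin n → A) → ∃ P →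
         ∃ λ z → P z × ∀ {x} → P x → f z ≼ f x
argmin total ≼-trans = argmax (flip total) (flip ≼-trans)

toSub-id : ∀ b → toSub b ≡ b
toSub-id true  = refl
toSub-id false = refl

module _ {n} (G : Digraph n) where

  ∈N⁺⁺ : ∀ {v u} → edge G v u ≡ true → u ∈ N⁺ G v
  ∈N⁺⁺ e = ∈-tabulate⁺ _ (trans (toSub-id _) e)

  ∈N⁺⁻ : ∀ {v u} → u ∈ N⁺ G v → edge G v u ≡ true
  ∈N⁺⁻ u∈ = trans (sym (toSub-id _)) (∈-tabulate⁻ _ u∈)

  ∈N⁻⁺ : ∀ {v u} → edge G u v ≡ true → u ∈ N⁻ G v
  ∈N⁻⁺ e = ∈-tabulate⁺ _ (trans (toSub-id _) e)

  ∈V⁺≤⁺ : ∀ {t u} → d⁺ G u ≤ t → u ∈ V⁺≤ G t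
  ∈V⁺≤⁺ le = ∈-tabulate⁺ _ (trans (toSub-id _) (Equivalence.to T-≡ (≤⇒≤ᵇ le)))

  ∈V⁺≤⁻ : ∀ {t u} → u ∈ V⁺≤ G t → d⁺ G u ≤ t
  ∈V⁺≤⁻ u∈ = ≤ᵇ⇒≤ _ _ (Equivalence.from T-≡ (trans (sym (toSub-id _)) (∈-tabulate⁻ _ u∈)))

  ∈V⁺≥⁺ : ∀ {t u} → t ≤ d⁺ G u → u ∈ V⁺≥ G t
  ∈V⁺≥⁺ le = ∈-tabulate⁺ _ (trans (toSub-id _) (Equivalence.to T-≡ (≤⇒≤ᵇ le)))

  ∈V⁺≥⁻ : ∀ {t u} → u ∈ V⁺≥ G t → t ≤ d⁺ G u
  ∈V⁺≥⁻ u∈ = ≤ᵇ⇒≤ _ _ (Equivalence.from T-≡ (trans (sym (toSub-id _)) (∈-tabulate⁻ _ u∈)))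

  edge⇒≢ : ∀ {u v} → edge G u v ≡ true → u ≢ v
  edge⇒≢ {u} e refl with trans (sym e) (loopless G u)
  ... | ()

module _ {n} {G : Digraph n} (D : PathDecomposition G) where

  private
    first : ∀ v → ∃ λ i → v ∈ bag D i × ∀ {j} → v ∈ bag D j → i Fin.≤ j
    first v = argmin Fin.≤-total Fin.≤-trans (λ i → v ∈? bag D i) id (cover D v)

    last : ∀ v → ∃ λ i → v ∈ bag D i × ∀ {j} → v ∈ bag D j → j Fin.≤ i
    last v = argmax Fin.≤-total Fin.≤-trans (λ i → v ∈? bag D i) id (cover D v)

  firstBag lastBag : Fin n → Fin (m D)
  firstBag = proj₁ ∘ first
  lastBag  = proj₁ ∘ last

  ∈firstBag : ∀ v → v ∈ bag D (firstBag v)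
  ∈firstBag = proj₁ ∘ proj₂ ∘ first

  ∈lastBag : ∀ v → v ∈ bag D (lastBag v)
  ∈lastBag = proj₁ ∘ proj₂ ∘ last

  firstBag-minimal : ∀ {v i} → v ∈ bag D i → firstBag v Fin.≤ i
  firstBag-minimal {v} = proj₂ (proj₂ (first v))

  lastBag-maximal : ∀ {v i} → v ∈ bag D i → i Fin.≤ lastBag v
  lastBag-maximal {v} = proj₂ (proj₂ (last v))

  edge⇒∈bag-firstBag : ∀ {u v} → edge G u v ≡ true → firstBag u Fin.≤ firstBag v → u ∈ bag D (firstBag v)
  edge⇒∈bag-firstBag {u} {v} e fu≤fv with edges D u v e
  ... | i , j , j≤i , u∈i , v∈j =
    interval D u (firstBag u) (firstBag v) i fu≤fv (Fin.≤-trans (firstBag-minimal v∈j) j≤i) (∈firstBag u) u∈i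

  edge⇒∈bag-lastBag : ∀ {u v} → edge G u v ≡ true → lastBag u Fin.≤ lastBag v → v ∈ bag D (lastBag u)
  edge⇒∈bag-lastBag {u} {v} e lu≤lv with edges D u v e
  ... | i , j , j≤i , u∈i , v∈j =
    interval D v j (lastBag u) (lastBag v) (Fin.≤-trans j≤i (lastBag-maximal u∈i)) lu≤lv v∈j (∈lastBag v)

module _ {n} {G : Digraph n} {p} (D : PathDecomposition G) (wid : WidthAtMost D p) where

  ∣V⁺≤t∣≤t+1+p : Semicomplete G → ∀ t → ∣ V⁺≤ G t ∣ ≤ t + suc p
  ∣V⁺≤t∣≤t+1+p sc t with nonempty? (V⁺≤ G t)
  ... | no  V-empty = subst (_≤ t + suc p) (sym (Empty⇒∣p∣≡0 V-empty)) z≤n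
  ... | yes V-nonempty with argmax Fin.≤-total Fin.≤-trans (_∈? V⁺≤ G t) (firstBag D) V-nonempty
  ...   | z , z∈V , latest = begin
    ∣ V⁺≤ G t ∣                           ≤⟨ p⊆q∪r⇒∣p∣≤∣q∣+∣r∣ (bag D (firstBag D z)) (N⁺ G z) covered ⟩
    ∣ bag D (firstBag D z) ∣ + d⁺ G z     ≤⟨ +-mono-≤ (wid _) (∈V⁺≤⁻ G z∈V) ⟩
    suc p + t                             ≡⟨ +-comm (suc p) t ⟩
    t + suc p                             ∎
    where
    open ≤-Reasoning
    covered : V⁺≤ G t ⊆ bag D (firstBag D z) ∪ N⁺ G z
    covered {x} x∈V with x ∈? bag D (firstBag D z)
    ... | yes x∈bag = x∈p∪q⁺ (inj₁ x∈bag)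
    ... | no  x∉bag with sc x z (λ { refl → x∉bag (∈firstBag D z) })
    ...   | inj₁ x→z = ⊥-elim (x∉bag (edge⇒∈bag-firstBag D x→z (latest x∈V)))
    ...   | inj₂ z→x = x∈p∪q⁺ (inj₂ (∈N⁺⁺ G z→x))

  t<d⁺⇒t<∣V⁺≤t∣+p : ∀ {t v} → t < d⁺ G v → t < ∣ V⁺≤ G t ∣ + p
  t<d⁺⇒t<∣V⁺≤t∣+p {t} {v} t<d⁺v
    with argmin Fin.≤-total Fin.≤-trans (_∈? V⁺≥ G (suc t)) (lastBag D) (v , ∈V⁺≥⁺ G t<d⁺v)
  ... | y , y∈V , earliest = begin-strict
    t                                            <⟨ ∈V⁺≥⁻ G y∈V ⟩
    d⁺ G y                                       ≤⟨ p⊆q∪r⇒∣p∣≤∣q∣+∣r∣ (V⁺≤ G t) (bag D (lastBag D y) - y) covered ⟩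
    ∣ V⁺≤ G t ∣ + ∣ bag D (lastBag D y) - y ∣    ≤⟨ +-monoʳ-≤ ∣ V⁺≤ G t ∣ ∣bag-y∣≤p ⟩
    ∣ V⁺≤ G t ∣ + p                              ∎
    where
    open ≤-Reasoning
    ∣bag-y∣≤p : ∣ bag D (lastBag D y) - y ∣ ≤ p
    ∣bag-y∣≤p = ≤-pred (≤-trans (x∈p⇒∣p-x∣<∣p∣ (∈lastBag D y)) (wid _))
    covered : N⁺ G y ⊆ V⁺≤ G t ∪ (bag D (lastBag D y) - y)
    covered {x} x∈N⁺y with d⁺ G x ≤? t
    ... | yes d⁺x≤t = x∈p∪q⁺ (inj₁ (∈V⁺≤⁺ G d⁺x≤t))
    ... | no  d⁺x≰t = x∈p∪q⁺ (inj₂ (x∈p∧x≢y⇒x∈p-y x∈bag (≢-sym (edge⇒≢ G y→x))))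
      where
      y→x = ∈N⁺⁻ G x∈N⁺y
      x∈bag = edge⇒∈bag-lastBag D y→x (earliest (∈V⁺≥⁺ G (≰⇒> d⁺x≰t)))

module _ {n} (G : Digraph n) where

  lowIn : ℕ → Fin n → Subset n
  lowIn d v = toSubset (λ u → (edge G u v ≟ᵇ true) ×-dec (d⁺ G u ≤? d))

  highOut : ℕ → Fin n → Subset n
  highOut s v = toSubset (λ u → (edge G v u ≟ᵇ true) ×-dec (s ≤? d⁺ G u))

  ∉N⁺⇒edge : Semicomplete G → ∀ {u v} → u ≢ v → u ∉ N⁺ G v → edge G u v ≡ true
  ∉N⁺⇒edge sc {u} {v} u≢v u∉N⁺v with sc u v u≢v
  ... | inj₁ u→v = u→v
  ... | inj₂ v→u = contradiction (∈N⁺⁺ G v→u) u∉N⁺v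

  wld≤∣lowIn∣+1 : Semicomplete G → ∀ {d v} → d⁺ G v ≤ d → wld G v ≤ ∣ lowIn d v ∣ + 1
  wld≤∣lowIn∣+1 sc {d} {v} d⁺v≤d = begin
    wld G v                       ≤⟨ p⊆q∪r⇒∣p∣≤∣q∣+∣r∣ (lowIn d v) ⁅ v ⁆ covered ⟩
    ∣ lowIn d v ∣ + ∣ ⁅ v ⁆ ∣     ≡⟨ cong (∣ lowIn d v ∣ +_) (∣⁅x⁆∣≡1 v) ⟩
    ∣ lowIn d v ∣ + 1             ∎
    where
    open ≤-Reasoning
    covered : V⁺≤ G (d⁺ G v) ─ N⁺ G v ⊆ lowIn d v ∪ ⁅ v ⁆
    covered {x} x∈ with x Fin.≟ v
    ... | yes refl = x∈p∪q⁺ (inj₂ (x∈⁅x⁆ v))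
    ... | no  x≢v  = x∈p∪q⁺ (inj₁ (∈toSubset⁺ _ (∉N⁺⇒edge sc x≢v (x∈p─q⇒x∉q x∈) , d⁺x≤d)))
      where d⁺x≤d = ≤-trans (∈V⁺≤⁻ G (p─q⊆p _ _ x∈)) d⁺v≤d

module _ {n} {G : Digraph n} (sc : Semicomplete G) {p} (D : PathDecomposition G) (wid : WidthAtMost D p) where

  ∣V⁺≤s─V⁺≤t∣≤s∸t+2p : ∀ {s t v} → t ≤ s → t < d⁺ G v → ∣ V⁺≤ G s ─ V⁺≤ G t ∣ ≤ (s ∸ t) + 2 * p
  ∣V⁺≤s─V⁺≤t∣≤s∸t+2p {s} {t} t≤s t<d⁺v = begin
    ∣ band ∣                 ≤⟨ m+n≤o⇒m≤o∸n ∣ band ∣ (≤-pred (subst (_≤ suc (s + 2 * p)) (+-suc _ t) counted)) ⟩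
    (s + 2 * p) ∸ t          ≡⟨ +-∸-comm (2 * p) t≤s ⟩
    (s ∸ t) + 2 * p          ∎
    where
    open ≤-Reasoning
    band = V⁺≤ G s ─ V⁺≤ G t
    counted : ∣ band ∣ + suc t ≤ suc (s + 2 * p)
    counted = begin
      ∣ band ∣ + suc t                      ≤⟨ +-monoʳ-≤ ∣ band ∣ (t<d⁺⇒t<∣V⁺≤t∣+p D wid t<d⁺v) ⟩
      ∣ band ∣ + (∣ V⁺≤ G t ∣ + p)          ≡⟨ +-assoc ∣ band ∣ _ p ⟨
      (∣ band ∣ + ∣ V⁺≤ G t ∣) + p          ≤⟨ +-monoˡ-≤ p (disjoint⇒∣p∣+∣q∣≤∣r∣ band (V⁺≤ G t) (V⁺≤ G s) (x∈p─q⇒x∉q) (p─q⊆p _ _)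
                                                  (λ x∈ → ∈V⁺≤⁺ G (≤-trans (∈V⁺≤⁻ G x∈) t≤s))) ⟩
      ∣ V⁺≤ G s ∣ + p                       ≤⟨ +-monoˡ-≤ p (∣V⁺≤t∣≤t+1+p D wid sc s) ⟩
      s + suc p + p                         ≡⟨ cong (_+ p) (+-suc s p) ⟩
      suc (s + p + p)                       ≡⟨ cong suc (+-assoc s p p) ⟩
      suc (s + (p + p))                     ≡⟨ cong (λ k → suc (s + (p + k))) (+-identityʳ p) ⟨
      suc (s + 2 * p)                       ∎

  wld≤∣lowIn∣+d⁺∸d+2p : ∀ {d v} → d < d⁺ G v → wld G v ≤ ∣ lowIn G d v ∣ + ((d⁺ G v ∸ d) + 2 * p)
  wld≤∣lowIn∣+d⁺∸d+2p {d} {v} d<d⁺v = begin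
    wld G v                                        ≤⟨ p⊆q∪r⇒∣p∣≤∣q∣+∣r∣ (lowIn G d v) band covered ⟩
    ∣ lowIn G d v ∣ + ∣ band ∣                     ≤⟨ +-monoʳ-≤ _ (∣V⁺≤s─V⁺≤t∣≤s∸t+2p (<⇒≤ d<d⁺v) d<d⁺v) ⟩
    ∣ lowIn G d v ∣ + ((d⁺ G v ∸ d) + 2 * p)       ∎
    where
    open ≤-Reasoning
    band = V⁺≤ G (d⁺ G v) ─ V⁺≤ G d
    covered : V⁺≤ G (d⁺ G v) ─ N⁺ G v ⊆ lowIn G d v ∪ band
    covered {x} x∈ with d⁺ G x ≤? d
    ... | yes d⁺x≤d = x∈p∪q⁺ (inj₁ (∈toSubset⁺ _ (∉N⁺⇒edge G sc x≢v (x∈p─q⇒x∉q x∈) , d⁺x≤d)))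
      where
      x≢v : x ≢ v
      x≢v refl = <⇒≱ d<d⁺v d⁺x≤d
    ... | no  d⁺x≰d = x∈p∪q⁺ (inj₂ (x∈p∧x∉q⇒x∈p─q (p─q⊆p _ _ x∈) (d⁺x≰d ∘ ∈V⁺≤⁻ G)))

  wld≤∣highOut∣+t∸d⁺+1+p : ∀ {s t v} → d⁺ G v ≤ t → (∀ {u} → edge G v u ≡ true → d⁺ G u < s → d⁺ G u ≤ t) →
                            wld G v ≤ ∣ highOut G s v ∣ + ((t ∸ d⁺ G v) + suc p)
  wld≤∣highOut∣+t∸d⁺+1+p {s} {t} {v} d⁺v≤t low⇒≤t = begin
    wld G v                                       ≤⟨ m+n≤o⇒m≤o∸n (wld G v) counted ⟩
    (∣ R ∣ + (t + suc p)) ∸ d⁺ G v                ≡⟨ +-∸-assoc ∣ R ∣ (≤-trans d⁺v≤t (m≤m+n t (suc p))) ⟩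
    ∣ R ∣ + ((t + suc p) ∸ d⁺ G v)                ≡⟨ cong (∣ R ∣ +_) (+-∸-comm (suc p) d⁺v≤t) ⟩
    ∣ R ∣ + ((t ∸ d⁺ G v) + suc p)                ∎
    where
    open ≤-Reasoning
    R = highOut G s v
    Y = N⁺ G v ─ R
    split : N⁺ G v ⊆ R ∪ Y
    split {x} x∈N⁺ with x ∈? R
    ... | yes x∈R = x∈p∪q⁺ (inj₁ x∈R)
    ... | no  x∉R = x∈p∪q⁺ (inj₂ (x∈p∧x∉q⇒x∈p─q x∈N⁺ x∉R))
    Y⊆V⁺≤t : Y ⊆ V⁺≤ G t
    Y⊆V⁺≤t {x} x∈Y with s ≤? d⁺ G x
    ... | yes s≤d⁺x = contradiction (∈toSubset⁺ _ (∈N⁺⁻ G x∈N⁺ , s≤d⁺x)) (x∈p─q⇒x∉q x∈Y)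
      where x∈N⁺ = p─q⊆p _ _ x∈Y
    ... | no  s≰d⁺x = ∈V⁺≤⁺ G (low⇒≤t (∈N⁺⁻ G (p─q⊆p _ _ x∈Y)) (≰⇒> s≰d⁺x))
    counted : wld G v + d⁺ G v ≤ ∣ R ∣ + (t + suc p)
    counted = begin
      wld G v + d⁺ G v                 ≤⟨ +-monoʳ-≤ (wld G v) (p⊆q∪r⇒∣p∣≤∣q∣+∣r∣ R Y split) ⟩
      wld G v + (∣ R ∣ + ∣ Y ∣)        ≡⟨ x∙yz≈y∙xz (wld G v) ∣ R ∣ ∣ Y ∣ ⟩
      ∣ R ∣ + (wld G v + ∣ Y ∣)        ≤⟨ +-monoʳ-≤ ∣ R ∣ (disjoint⇒∣p∣+∣q∣≤∣r∣ (V⁺≤ G (d⁺ G v) ─ N⁺ G v) Y (V⁺≤ G t)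
                                             (λ x∈ x∈Y → x∈p─q⇒x∉q x∈ (p─q⊆p _ _ x∈Y))
                                             (λ x∈ → ∈V⁺≤⁺ G (≤-trans (∈V⁺≤⁻ G (p─q⊆p _ _ x∈)) d⁺v≤t))
                                             Y⊆V⁺≤t) ⟩
      ∣ R ∣ + ∣ V⁺≤ G t ∣              ≤⟨ +-monoʳ-≤ ∣ R ∣ (∣V⁺≤t∣≤t+1+p D wid sc t) ⟩
      ∣ R ∣ + (t + suc p)              ∎

restrict : ∀ {n} {G : Digraph n} {d k l w} (M : MatchingTangle G d k w) (q : Subset n) →
           q ⊆ T₁ M → ∣ q ∣ ≡ l → MatchingTangle G d l w
restrict M q q⊆T₁ ∣q∣≡l = record
  { T₁      = q
  ; T₂      = image (φ M) q
  ; size₁   = ∣q∣≡l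
  ; size₂   = trans (∣image∣≡∣p∣ (φ M) injective) ∣q∣≡l
  ; T₁-low  = T₁-low M ∘ q⊆T₁
  ; T₂-high = λ y∈ → let (x , x∈q , φx≡y) = ∈image⁻ (φ M) q y∈ in
                     subst (_∈ _) φx≡y (T₂-high M (φ-into M (q⊆T₁ x∈q)))
  ; φ       = φ M
  ; φ-into  = ∈image⁺ (φ M) q
  ; φ-inj   = injective
  ; φ-onto  = ∈image⁻ (φ M) q
  ; φ-edge  = φ-edge M ∘ q⊆T₁
  }
  where
  injective : ∀ {x y} → x ∈ q → y ∈ q → φ M x ≡ φ M y → x ≡ y
  injective x∈q y∈q = φ-inj M (q⊆T₁ x∈q) (q⊆T₁ y∈q)

module _ {n} (G : Digraph n) (d l w p : ℕ) where

  TameLow TameHigh : Fin n → Set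
  TameLow  v = wld G v ≤ 3 * l + (d + w ∸ d⁺ G v) + 2 * p
  TameHigh v = wld G v ≤ 3 * l + (d⁺ G v ∸ d) + 2 * p

excess⇒≤ : ∀ {a K q W X s} → a + K + q < W → W ≤ X + s → s ≤ K + q → a ≤ X
excess⇒≤ {a} {K} {q} {W} {X} {s} a+K+q<W W≤X+s s≤K+q = <⇒≤ (+-cancelʳ-< (K + q) a X (begin-strict
  a + (K + q)     ≡⟨ +-assoc a K q ⟨
  a + K + q       <⟨ a+K+q<W ⟩
  W               ≤⟨ W≤X+s ⟩
  X + s           ≤⟨ +-monoʳ-≤ X s≤K+q ⟩
  X + (K + q)     ∎))
  where open ≤-Reasoning

module _ {n} {G : Digraph n} (sc : Semicomplete G) {p} (D : PathDecomposition G) (wid : WidthAtMost D p)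
         {d l w'} (M : MatchingTangle G d (3 * l) (suc w')) where

  private
    w = suc w'
    TameLow? : Decidable (TameLow G d l w p)
    TameLow? v = _ ≤? _
    TameHigh? : Decidable (TameHigh G d l w p)
    TameHigh? v = _ ≤? _
    p≤2p : p ≤ 2 * p
    p≤2p = m≤m+n p _
    T₁⇒d⁺≤d : ∀ {v} → v ∈ T₁ M → d⁺ G v ≤ d
    T₁⇒d⁺≤d = ∈V⁺≤⁻ G ∘ T₁-low M
    T₂⇒d+w<d⁺ : ∀ {v} → v ∈ T₂ M → d + w < d⁺ G v
    T₂⇒d+w<d⁺ v∈T₂ = <-≤-trans (m<m+n (d + w) (s≤s z≤n)) (∈V⁺≥⁻ G (T₂-high M v∈T₂))

  Wild : Fin n → Set
  Wild v = (v ∈ T₁ M × ¬ TameLow G d l w p v) ⊎ (v ∈ T₂ M × ¬ TameHigh G d l w p v)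

  Wild? : Decidable Wild
  Wild? v = (v ∈? T₁ M ×-dec ¬? (TameLow? v)) ⊎-dec (v ∈? T₂ M ×-dec ¬? (TameHigh? v))

  wild : Subset n
  wild = toSubset Wild?

  Wild⇒3l≤∣lowIn∣ : ∀ {v} → Wild v → 3 * l ≤ ∣ lowIn G d v ∣
  Wild⇒3l≤∣lowIn∣ {v} (inj₁ (v∈T₁ , untame)) =
    excess⇒≤ (≰⇒> untame) (wld≤∣lowIn∣+1 G sc d⁺v≤d) (≤-trans (m<n⇒0<n∸m d⁺v<d+w) (m≤m+n _ _))
    where
    d⁺v≤d = T₁⇒d⁺≤d v∈T₁
    d⁺v<d+w = ≤-<-trans d⁺v≤d (m<m+n d (s≤s z≤n))
  Wild⇒3l≤∣lowIn∣ {v} (inj₂ (v∈T₂ , untame)) =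
    excess⇒≤ (≰⇒> untame) (wld≤∣lowIn∣+d⁺∸d+2p sc D wid d<d⁺v) ≤-refl
    where
    d<d⁺v = ≤-<-trans (m≤m+n d w) (T₂⇒d+w<d⁺ v∈T₂)

  Wild⇒3l≤∣highOut∣ : ∀ {v} → Wild v → 3 * l ≤ ∣ highOut G (d + w) v ∣
  Wild⇒3l≤∣highOut∣ {v} (inj₁ (v∈T₁ , untame)) =
    excess⇒≤ (≰⇒> untame) (wld≤∣highOut∣+t∸d⁺+1+p sc D wid d⁺v≤d+w' low⇒≤d+w') slack
    where
    open ≤-Reasoning
    d⁺v≤d+w' = ≤-trans (T₁⇒d⁺≤d v∈T₁) (m≤m+n d w')
    low⇒≤d+w' : ∀ {u} → edge G v u ≡ true → d⁺ G u < d + w → d⁺ G u ≤ d + w'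
    low⇒≤d+w' {u} _ d⁺u<d+w = ≤-pred (subst (d⁺ G u <_) (+-suc d w') d⁺u<d+w)
    slack : (d + w' ∸ d⁺ G v) + suc p ≤ (d + w ∸ d⁺ G v) + 2 * p
    slack = begin
      (d + w' ∸ d⁺ G v) + suc p         ≡⟨ +-suc _ p ⟩
      suc (d + w' ∸ d⁺ G v) + p         ≡⟨ cong (_+ p) (+-∸-assoc 1 d⁺v≤d+w') ⟨
      (suc (d + w') ∸ d⁺ G v) + p       ≡⟨ cong (λ k → (k ∸ d⁺ G v) + p) (+-suc d w') ⟨
      (d + w ∸ d⁺ G v) + p              ≤⟨ +-monoʳ-≤ _ p≤2p ⟩
      (d + w ∸ d⁺ G v) + 2 * p          ∎
  Wild⇒3l≤∣highOut∣ {v} (inj₂ (v∈T₂ , untame)) =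
    excess⇒≤ (≰⇒> untame) (wld≤∣highOut∣+t∸d⁺+1+p sc D wid ≤-refl low⇒≤d⁺v) slack
    where
    open ≤-Reasoning
    low⇒≤d⁺v : ∀ {u} → edge G v u ≡ true → d⁺ G u < d + w → d⁺ G u ≤ d⁺ G v
    low⇒≤d⁺v _ d⁺u<d+w = <⇒≤ (<-trans d⁺u<d+w (T₂⇒d+w<d⁺ v∈T₂))
    slack : (d⁺ G v ∸ d⁺ G v) + suc p ≤ (d⁺ G v ∸ d) + 2 * p
    slack = begin
      (d⁺ G v ∸ d⁺ G v) + suc p         ≡⟨ cong (_+ suc p) (n∸n≡0 (d⁺ G v)) ⟩
      suc p                             ≤⟨ +-mono-≤ (m<n⇒0<n∸m (≤-<-trans (m≤m+n d w) (T₂⇒d+w<d⁺ v∈T₂))) p≤2p ⟩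
      (d⁺ G v ∸ d) + 2 * p              ∎

  spider : l ≤ ∣ wild ∣ → Spider G d l w
  spider l≤∣wild∣ = record
    { T      = wild
    ; sizeT  = l≤∣wild∣
    ; L      = lowIn G d
    ; R      = highOut G (d + w)
    ; L-in   = λ _ u∈ → ∈N⁻⁺ G (proj₁ (∈toSubset⁻ _ u∈))
    ; L-size = Wild⇒3l≤∣lowIn∣ ∘ ∈toSubset⁻ _
    ; L-low  = λ _ u∈ → proj₂ (∈toSubset⁻ _ u∈)
    ; R-in   = λ _ u∈ → ∈N⁺⁺ G (proj₁ (∈toSubset⁻ _ u∈))
    ; R-size = Wild⇒3l≤∣highOut∣ ∘ ∈toSubset⁻ _
    ; R-high = λ _ u∈ → proj₂ (∈toSubset⁻ _ u∈)
    }

  TamePair : Fin n → Set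
  TamePair v = v ∈ T₁ M × TameLow G d l w p v × TameHigh G d l w p (φ M v)

  tamePairs : Subset n
  tamePairs = toSubset (λ v → v ∈? T₁ M ×-dec TameLow? v ×-dec TameHigh? (φ M v))

  WildPartner : Fin n → Set
  WildPartner v = v ∈ T₁ M × φ M v ∈ wild

  wildPartners : Subset n
  wildPartners = toSubset (λ v → v ∈? T₁ M ×-dec φ M v ∈? wild)

  T₁⊆tamePairs∪wild∪wildPartners : T₁ M ⊆ tamePairs ∪ (wild ∪ wildPartners)
  T₁⊆tamePairs∪wild∪wildPartners {v} v∈T₁ with TameLow? v | TameHigh? (φ M v)
  ... | no  untame₁ | _           = x∈p∪q⁺ (inj₂ (x∈p∪q⁺ (inj₁ (∈toSubset⁺ Wild? (inj₁ (v∈T₁ , untame₁))))))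
  ... | yes _       | no  untame₂ =
    x∈p∪q⁺ (inj₂ (x∈p∪q⁺ (inj₂ (∈toSubset⁺ _ (v∈T₁ , ∈toSubset⁺ Wild? (inj₂ (φ-into M v∈T₁ , untame₂)))))))
  ... | yes tame₁   | yes tame₂   = x∈p∪q⁺ (inj₁ (∈toSubset⁺ _ (v∈T₁ , tame₁ , tame₂)))

  ∣wildPartners∣≤∣wild∣ : ∣ wildPartners ∣ ≤ ∣ wild ∣
  ∣wildPartners∣≤∣wild∣ = injective⇒∣p∣≤∣q∣ (φ M) (proj₂ ∘ partner) (λ x∈ y∈ → φ-inj M (proj₁ (partner x∈)) (proj₁ (partner y∈)))
    where
    partner : ∀ {v} → v ∈ wildPartners → WildPartner v
    partner = ∈toSubset⁻ _

  l≤∣tamePairs∣ : ∣ wild ∣ < l → l ≤ ∣ tamePairs ∣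
  l≤∣tamePairs∣ ∣wild∣<l = <⇒≤ (+-cancelʳ-< (l + l) l ∣ tamePairs ∣ (begin-strict
    l + (l + l)                                     ≡⟨ cong (λ k → l + (l + k)) (+-identityʳ l) ⟨
    3 * l                                           ≡⟨ size₁ M ⟨
    ∣ T₁ M ∣                                        ≤⟨ p⊆q∪r⇒∣p∣≤∣q∣+∣r∣ tamePairs (wild ∪ wildPartners)
                                                         T₁⊆tamePairs∪wild∪wildPartners ⟩
    ∣ tamePairs ∣ + ∣ wild ∪ wildPartners ∣         ≤⟨ +-monoʳ-≤ ∣ tamePairs ∣ (p⊆q∪r⇒∣p∣≤∣q∣+∣r∣ wild wildPartners id) ⟩
    ∣ tamePairs ∣ + (∣ wild ∣ + ∣ wildPartners ∣)   ≤⟨ +-monoʳ-≤ ∣ tamePairs ∣ (+-monoʳ-≤ ∣ wild ∣ ∣wildPartners∣≤∣wild∣) ⟩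
    ∣ tamePairs ∣ + (∣ wild ∣ + ∣ wild ∣)           <⟨ +-monoʳ-< ∣ tamePairs ∣ (+-mono-< ∣wild∣<l ∣wild∣<l) ⟩
    ∣ tamePairs ∣ + (l + l)                         ∎))
    where open ≤-Reasoning

  tame : ∣ wild ∣ < l → Σ (MatchingTangle G d l w) (Tame p)
  tame ∣wild∣<l with subsetOfSize l tamePairs (l≤∣tamePairs∣ ∣wild∣<l)
  ... | q , q⊆tamePairs , ∣q∣≡l = restrict M q (proj₁ ∘ pair) ∣q∣≡l , proj₁ ∘ proj₂ ∘ pair , tame₂
    where
    pair : ∀ {v} → v ∈ q → TamePair v
    pair = ∈toSubset⁻ _ ∘ q⊆tamePairs
    tame₂ : ∀ {y} → y ∈ image (φ M) q → TameHigh G d l w p y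
    tame₂ y∈ with ∈image⁻ (φ M) q y∈
    ... | x , x∈q , refl = proj₂ (proj₂ (pair x∈q))

lemma15 : ∀ {n} (G : Digraph n) → Semicomplete G →
          (d l w : ℕ) → 0 < l → 0 < w →
          (pw : ℕ) → IsPathwidth G pw →
          MatchingTangle G d (3 * l) w →
          (Σ (MatchingTangle G d l w) λ M → Tame pw M) ⊎ Spider G d l w
lemma15 G sc d l (suc w') _ _ pw ((D , wid) , _) M with l ≤? ∣ wild sc D wid {l = l} M ∣
... | yes l≤∣wild∣ = inj₂ (spider sc D wid M l≤∣wild∣)
... | no  l≰∣wild∣ = inj₁ (tame sc D wid M (≰⇒> l≰∣wild∣))
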